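{- Let $h,n,k$ be positive integers with $n-k\geq 2h$. There exists a $q$-linear code with parameters $[n,k,d]$ such that $d\geq 2h+1$ if and only if there exists an $S_h$-linear set with $n+1$ elements in $\mathbb{F}_q^{n-k}$.
   Context: An $[n,k,d]$ $q$-linear code is a $k$-dimensional subspace $\mathcal{C}$ of $\mathbb{F}_q^n$ whose minimum distance $d$ (the minimum Hamming weight, i.e. number of non-zero coordinates, of a non-zero codeword) equals $d$. For a non-empty subset $A$ of $\mathbb{F}_q^r$ and a positive integer $h\leq|A|$, an $h$-linear combination of $A$ is an expression $\lambda_1\boldsymbol{a}_1+\cdots+\lambda_h\boldsymbol{a}_h$ with $\lambda_i\in\mathbb{F}_q^*$ and $\boldsymbol{a}_1,\dots,\boldsymbol{a}_h$ distinct elements of $A$. $A$ is an $S_h$-linear set if all $h$-linear combinations of elements of $A$, omitting permutations of the summands, yield distinct elements of $\mathbb{F}_q^r$ (combinations differing only in the scalar attached to $\boldsymbol{0}$ being regarded as the same). -}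

module Defs where

open import Data.Nat using (ℕ; zero; suc; _≤_)
open import Data.Fin using (Fin)
import Data.Fin as Fin
open import Data.Vec using (Vec; []; _∷_; lookup; replicate; zipWith; map; count)
open import Data.Product using (Σ; ∃; _×_; _,_)
open import Relation.Nullary using (¬_)
open import Relation.Nullary.Decidable using (¬?)
open import Relation.Binary.PropositionalEquality using (_≡_)
open import Relation.Binary.Definitions using (DecidableEquality)
open import Algebra.Structures using (IsCommutativeRing)
open import Function.Bundles using (_↔_)

record FiniteField : Set₁ where
  field
    Carrier : Set
    _+_ _*_ : Carrier → Carrier → Carrier
    -_ : Carrier → Carrier
    0# 1# : Carrier
    isCommutativeRing : IsCommutativeRing _≡_ _+_ _*_ -_ 0# 1#
    0≢1 : ¬ (0# ≡ 1#)
    inverse : ∀ x → ¬ (x ≡ 0#) → ∃ λ y → x * y ≡ 1#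
    _≟_ : DecidableEquality Carrier
    q : ℕ
    enumeration : Fin q ↔ Carrier

module _ (F : FiniteField) where
  open FiniteField F

  zeroVec : (r : ℕ) → Vec Carrier r
  zeroVec r = replicate r 0#

  _+v_ : ∀ {r} → Vec Carrier r → Vec Carrier r → Vec Carrier r
  u +v v = zipWith _+_ u v

  _·v_ : ∀ {r} → Carrier → Vec Carrier r → Vec Carrier r
  s ·v v = map (s *_) v

  lincomb : ∀ {m r} → Vec Carrier m → (Fin m → Vec Carrier r) → Vec Carrier r
  lincomb {r = r} [] a = zeroVec r
  lincomb (c ∷ cs) a = (c ·v a Fin.zero) +v lincomb cs (λ i → a (Fin.suc i))

  weight : ∀ {r} → Vec Carrier r → ℕ
  weight v = count (λ x → ¬? (x ≟ 0#)) v

  record LinearCode (n k : ℕ) : Set where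
    field
      basis : Fin k → Vec Carrier n
      independent : (c : Vec Carrier k) → lincomb c basis ≡ zeroVec n →
                    (i : Fin k) → lookup c i ≡ 0#

  IsCodeword : ∀ {n k} → LinearCode n k → Vec Carrier n → Set
  IsCodeword C v = ∃ λ c → lincomb c (LinearCode.basis C) ≡ v

  MinDistance : ∀ {n k} → LinearCode n k → ℕ → Set
  MinDistance {n} C d =
    (∃ λ v → IsCodeword C v × ¬ (v ≡ zeroVec n) × weight v ≡ d) ×
    ((v : Vec Carrier n) → IsCodeword C v → ¬ (v ≡ zeroVec n) → d ≤ weight v)

  record Code[_,_,_] (n k d : ℕ) : Set where
    field
      code : LinearCode n k
      minDist : MinDistance code d

  -- A subset A of F^r with m elements, listed injectively as a : Fin m → F^r.
  -- An h-linear combination is given by a coefficient vector c ∈ F^m with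
  -- exactly h non-zero entries (the chosen summands and their non-zero
  -- scalars; permutations of the summands are thereby identified).
  -- S_h: equal values force the same combination, except that the scalar
  -- attached to the zero vector (if 0 ∈ A) may differ.
  IsSₕLinearSet : (h : ℕ) {m r : ℕ} → (Fin m → Vec Carrier r) → Set
  IsSₕLinearSet h {m} {r} a =
    (c c′ : Vec Carrier m) → weight c ≡ h → weight c′ ≡ h →
    lincomb c a ≡ lincomb c′ a →
    (i : Fin m) → (lookup c i ≡ 0# → lookup c′ i ≡ 0#) ×
                  (lookup c′ i ≡ 0# → lookup c i ≡ 0#) ×
                  (¬ (a i ≡ zeroVec r) → lookup c i ≡ lookup c′ i)

  record SₕLinearSet (h m r : ℕ) : Set where
    field
      elems : Fin m → Vec Carrier r
      distinct : (i j : Fin m) → elems i ≡ elems j → i ≡ j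
      sₕ : IsSₕLinearSet h elems

module Submission where

-- A parity-check matrix H of an [n,k] code has n columns in F^(n−k), and the code has minimum distance
-- greater than 2h exactly when any 2h columns of H are linearly independent. For such an H, the columns
-- together with 0 form an S_h-set: two h-combinations with the same value differ by a relation of weight
-- at most 2h, which is trivial. Conversely, drop one element of an S_h-set of n + 1 vectors (the zero
-- vector if present) to get the columns of H. A relation of weight at most 2h among them, extended by one
-- coordinate, is a relation of weight at most 2h among the elements of the set, and so a difference c − c′
-- of two h-combinations (pad both with equal scalars off its support, and split the support evenly). An
-- odd weight needs one coordinate y written as a difference of two nonzero scalars; this is possible
-- unless q = 2. The scalar of the zero vector, or over F₂ the sum of the relation (taking the columns
-- a(j+1) + a(0)), makes the weight even instead. The S_h property forces c = c′, so the relation is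
-- trivial, and Gaussian elimination finds a k-dimensional code inside the kernel of H.

open import Defs
open import Algebra.Bundles using (CommutativeRing)
import Algebra.Properties.CommutativeSemigroup as CommutativeSemigroupProperties
import Algebra.Properties.Ring as RingProperties
open import Data.Empty using (⊥-elim)
open import Data.Fin as Fin using (Fin; punchIn)
open import Data.Fin.Properties using (any?; punchInᵢ≢i)
open import Data.Nat as ℕ using (ℕ; zero; suc; _≤_; _<_; _∸_; z≤n; s≤s) renaming (_+_ to _+ℕ_)
open import Data.Nat.Induction using (<-rec)
import Data.Nat.Properties as ℕₚ
open import Data.Product using (Σ; ∃; _×_; _,_; proj₁; proj₂; map₂)
open import Data.Sum using (_⊎_; inj₁; inj₂)
open import Data.Vec using (Vec; []; _∷_; tail; lookup; insertAt; removeAt)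
open import Data.Vec.Functional using () renaming (_∷_ to _∷ᶠ_)
open import Data.Vec.Properties
  using (≡-dec; count≤n; lookup-zipWith; lookup-map; lookup-replicate; ∷-injectiveˡ; ∷-injectiveʳ;
         insertAt-punchIn; insertAt-removeAt; removeAt-insertAt)
open import Data.Vec.Relation.Binary.Pointwise.Extensional using (ext; Pointwise-≡⇒≡)
open import Function using (_∘_)
open import Function.Bundles using (Inverse)
open import Relation.Binary.PropositionalEquality
open import Relation.Nullary using (¬_; Dec; yes; no; _×-dec_)
open import Relation.Nullary.Decidable using (¬?; map′)

open CommutativeSemigroupProperties ℕₚ.+-commutativeSemigroup using ()
  renaming (x∙yz≈y∙xz to x+[y+z]≡y+[x+z]; x∙yz≈yx∙z to x+[y+z]≡[y+x]+z;
            interchange to x+y+[z+w]≡x+z+[y+w])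

Even : ℕ → Set
Even w = ∃ λ A → w ≡ A +ℕ A

even-or-odd : ∀ w → Even w ⊎ ∃ λ A → w ≡ suc (A +ℕ A)
even-or-odd zero    = inj₁ (0 , refl)
even-or-odd (suc w) with even-or-odd w
... | inj₁ (A , w≡A+A)   = inj₂ (A , cong suc w≡A+A)
... | inj₂ (A , w≡1+A+A) = inj₁ (suc A , trans (cong suc w≡1+A+A) (cong suc (sym (ℕₚ.+-suc A A))))

m+m≤n+n⇒m≤n : ∀ {m n} → m +ℕ m ≤ n +ℕ n → m ≤ n
m+m≤n+n⇒m≤n m+m≤n+n = ℕₚ.≮⇒≥ λ n<m → ℕₚ.<⇒≱ (ℕₚ.+-mono-< n<m n<m) m+m≤n+n

1+m+m≤n+n⇒m<n : ∀ {m n} → suc (m +ℕ m) ≤ n +ℕ n → m < n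
1+m+m≤n+n⇒m<n m+m<n+n = ℕₚ.≰⇒> λ n≤m → ℕₚ.<⇒≱ m+m<n+n (ℕₚ.+-mono-≤ n≤m n≤m)

Least : (ℕ → Set) → ℕ → Set
Least P m = P m × (∀ {v} → v < m → ¬ P v)

least : {P : ℕ → Set} → (∀ w → Dec (P w)) → ∀ {w} → P w → ∃ (Least P)
least {P} P? {w} = <-rec (λ w → P w → ∃ (Least P)) step w
  where
  step : ∀ w → (∀ {v} → v < w → P v → ∃ (Least P)) → P w → ∃ (Least P)
  step w smaller Pw with ℕₚ.anyUpTo? P? w
  ... | yes (v , v<w , Pv) = smaller v<w Pv
  ... | no  none           = w , Pw , λ v<w Pv → none (_ , v<w , Pv)

module _ (F : FiniteField) where

  open FiniteField F using (Carrier; isCommutativeRing; 0≢1; inverse; _≟_; enumeration)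
  open Inverse enumeration using (to; from) renaming (strictlyInverseˡ to to∘from)

  ring : CommutativeRing _ _
  ring = record { isCommutativeRing = isCommutativeRing }

  open CommutativeRing ring
    using (_+_; _*_; -_; 0#; 1#; +-assoc; +-comm; +-identityˡ; +-identityʳ; -‿inverseˡ; -‿inverseʳ;
           *-assoc; *-comm; *-identityˡ; *-identityʳ; distribˡ; distribʳ; zeroˡ; zeroʳ;
           +-commutativeSemigroup; *-commutativeSemigroup)
  open RingProperties (CommutativeRing.ring ring)
    using (-‿distribˡ-*; -1*x≈-x; -0#≈0#; -‿injective; +-inverseˡ-unique; +-inverseʳ-unique;
           x∙y⁻¹≈ε⇒x≈y; +-cancelʳ)
  open CommutativeSemigroupProperties +-commutativeSemigroup using (interchange; x∙yz≈y∙xz)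
  open CommutativeSemigroupProperties *-commutativeSemigroup using () renaming (x∙yz≈y∙xz to x*yz≡y*xz)
  open ≡-Reasoning

  1≢0 : 1# ≢ 0#
  1≢0 1≡0 = 0≢1 (sym 1≡0)

  -‿≢0 : ∀ {x} → x ≢ 0# → - x ≢ 0#
  -‿≢0 x≢0 -x≡0 = x≢0 (-‿injective (trans -x≡0 (sym -0#≈0#)))

  x+y≡y⇒x≡0 : ∀ x y → x + y ≡ y → x ≡ 0#
  x+y≡y⇒x≡0 x y eq = +-cancelʳ y x 0# (trans eq (sym (+-identityˡ y)))

  -u*x*a≡-x : ∀ {a u} → a * u ≡ 1# → ∀ x → (- u * x) * a ≡ - x
  -u*x*a≡-x {a} {u} au≡1 x = begin
    (- u * x) * a      ≡⟨ *-assoc (- u) x a ⟩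
    - u * (x * a)      ≡⟨ sym (-‿distribˡ-* u _) ⟩
    - (u * (x * a))    ≡⟨ cong -_ (x*yz≡y*xz u x a) ⟩
    - (x * (u * a))    ≡⟨ cong (λ z → - (x * z)) (trans (*-comm u a) au≡1) ⟩
    - (x * 1#)         ≡⟨ cong -_ (*-identityʳ x) ⟩
    - x                ∎

  Vector : ℕ → Set
  Vector = Vec Carrier

  0v : (n : ℕ) → Vector n
  0v = zeroVec F

  infixl 6 _⊕_ _⊖_
  infixr 7 _⊙_

  _⊕_ : ∀ {n} → Vector n → Vector n → Vector n
  _⊕_ = _+v_ F

  _⊙_ : ∀ {n} → Carrier → Vector n → Vector n
  _⊙_ = _·v_ F

  _⊖_ : ∀ {n} → Vector n → Vector n → Vector n
  u ⊖ v = u ⊕ (- 1#) ⊙ v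

  lc : ∀ {m n} → Vector m → (Fin m → Vector n) → Vector n
  lc = lincomb F

  wt : ∀ {n} → Vector n → ℕ
  wt = weight F

  vec-ext : ∀ {n} {u v : Vector n} → (∀ i → lookup u i ≡ lookup v i) → u ≡ v
  vec-ext eq = Pointwise-≡⇒≡ (ext eq)

  lookup-⊕ : ∀ {n} (u v : Vector n) i → lookup (u ⊕ v) i ≡ lookup u i + lookup v i
  lookup-⊕ u v i = lookup-zipWith _+_ i u v

  lookup-⊙ : ∀ {n} s (v : Vector n) i → lookup (s ⊙ v) i ≡ s * lookup v i
  lookup-⊙ s v i = lookup-map i (s *_) v

  lookup-0v : ∀ {n} (i : Fin n) → lookup (0v n) i ≡ 0#
  lookup-0v i = lookup-replicate i 0#

  lookup-⊖ : ∀ {n} (u v : Vector n) i → lookup (u ⊖ v) i ≡ lookup u i + - lookup v i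
  lookup-⊖ u v i =
    trans (lookup-⊕ u _ i) (cong (lookup u i +_) (trans (lookup-⊙ (- 1#) v i) (-1*x≈-x _)))

  0v⊕ : ∀ {n} (v : Vector n) → 0v n ⊕ v ≡ v
  0v⊕ {n} v = vec-ext λ i →
    trans (lookup-⊕ (0v n) v i) (trans (cong (_+ lookup v i) (lookup-0v i)) (+-identityˡ _))

  ⊙0v : ∀ {n} s → s ⊙ 0v n ≡ 0v n
  ⊙0v {n} s = vec-ext λ i →
    trans (lookup-⊙ s (0v n) i) (trans (cong (s *_) (lookup-0v i)) (trans (zeroʳ s) (sym (lookup-0v i))))

  0#⊙ : ∀ {n} (v : Vector n) → 0# ⊙ v ≡ 0v n
  0#⊙ v = vec-ext λ i → trans (lookup-⊙ 0# v i) (trans (zeroˡ _) (sym (lookup-0v i)))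

  ⊕-comm : ∀ {n} (u v : Vector n) → u ⊕ v ≡ v ⊕ u
  ⊕-comm u v = vec-ext λ i → trans (lookup-⊕ u v i) (trans (+-comm _ _) (sym (lookup-⊕ v u i)))

  ⊖-self : ∀ {n} (v : Vector n) → v ⊖ v ≡ 0v n
  ⊖-self v = vec-ext λ i → trans (lookup-⊖ v v i) (trans (-‿inverseʳ _) (sym (lookup-0v i)))

  u⊖v≡0⇒u≡v : ∀ {n} {u v : Vector n} → u ⊖ v ≡ 0v n → u ≡ v
  u⊖v≡0⇒u≡v {u = u} {v} eq = vec-ext λ i →
    x∙y⁻¹≈ε⇒x≈y _ _ (trans (sym (lookup-⊖ u v i)) (trans (cong (λ w → lookup w i) eq) (lookup-0v i)))

  u⊖v≡w⇒w⊕v≡u : ∀ {n} {u v w : Vector n} → u ⊖ v ≡ w → w ⊕ v ≡ u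
  u⊖v≡w⇒w⊕v≡u {u = u} {v} {w} eq = vec-ext λ i → begin
    lookup (w ⊕ v) i                       ≡⟨ lookup-⊕ w v i ⟩
    lookup w i + lookup v i                ≡⟨ cong (λ z → lookup z i + lookup v i) (sym eq) ⟩
    lookup (u ⊖ v) i + lookup v i          ≡⟨ cong (_+ lookup v i) (lookup-⊖ u v i) ⟩
    (lookup u i + - lookup v i) + lookup v i ≡⟨ +-assoc _ _ _ ⟩
    lookup u i + (- lookup v i + lookup v i) ≡⟨ cong (lookup u i +_) (-‿inverseˡ _) ⟩
    lookup u i + 0#                        ≡⟨ +-identityʳ _ ⟩
    lookup u i                             ∎

  -c⊙v⊕c⊙v≡0v : ∀ {n} c (v : Vector n) → (- c) ⊙ v ⊕ c ⊙ v ≡ 0v n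
  -c⊙v⊕c⊙v≡0v c v = vec-ext λ i → begin
    lookup ((- c) ⊙ v ⊕ c ⊙ v) i              ≡⟨ lookup-⊕ ((- c) ⊙ v) (c ⊙ v) i ⟩
    lookup ((- c) ⊙ v) i + lookup (c ⊙ v) i   ≡⟨ cong₂ _+_ (lookup-⊙ (- c) v i) (lookup-⊙ c v i) ⟩
    - c * lookup v i + c * lookup v i         ≡⟨ cong (_+ c * lookup v i) (sym (-‿distribˡ-* c _)) ⟩
    - (c * lookup v i) + c * lookup v i       ≡⟨ -‿inverseˡ _ ⟩
    0#                                        ≡⟨ sym (lookup-0v i) ⟩
    lookup (0v _) i                           ∎

  nonzero-coordinate : ∀ {n} (v : Vector n) → v ≢ 0v n → ∃ λ j → lookup v j ≢ 0#
  nonzero-coordinate []       v≢0 = ⊥-elim (v≢0 refl)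
  nonzero-coordinate (x ∷ xs) v≢0 with x ≟ 0#
  ... | no  x≢0 = Fin.zero , x≢0
  ... | yes x≡0 = let j , xsⱼ≢0 = nonzero-coordinate xs (v≢0 ∘ cong₂ _∷_ x≡0) in Fin.suc j , xsⱼ≢0

  lookup-⊕⊙ : ∀ {n} (y : Vector n) c g i → lookup (y ⊕ c ⊙ g) i ≡ lookup y i + c * lookup g i
  lookup-⊕⊙ y c g i = trans (lookup-⊕ y (c ⊙ g) i) (cong (lookup y i +_) (lookup-⊙ c g i))

  dot : ∀ {n} → Vector n → (Fin n → Carrier) → Carrier
  dot []       f = 0#
  dot (x ∷ xs) f = x * f Fin.zero + dot xs (λ i → f (Fin.suc i))

  lookup-lc : ∀ {m n} (c : Vector m) (a : Fin m → Vector n) j →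
              lookup (lc c a) j ≡ dot c (λ i → lookup (a i) j)
  lookup-lc []       a j = lookup-0v j
  lookup-lc (c ∷ cs) a j = trans (lookup-⊕ (c ⊙ a Fin.zero) _ j)
    (cong₂ _+_ (lookup-⊙ c (a Fin.zero) j) (lookup-lc cs (λ i → a (Fin.suc i)) j))

  dot-cong : ∀ {n} (x : Vector n) {f g} → (∀ i → f i ≡ g i) → dot x f ≡ dot x g
  dot-cong []       eq = refl
  dot-cong (x ∷ xs) eq = cong₂ _+_ (cong (x *_) (eq Fin.zero)) (dot-cong xs (λ i → eq (Fin.suc i)))

  dot-⊕ : ∀ {n} (x y : Vector n) f → dot (x ⊕ y) f ≡ dot x f + dot y f
  dot-⊕ []       []       f = sym (+-identityʳ 0#)
  dot-⊕ (x ∷ xs) (y ∷ ys) f =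
    trans (cong₂ _+_ (distribʳ (f Fin.zero) x y) (dot-⊕ xs ys _)) (interchange _ _ _ _)

  dot-⊙ : ∀ {n} s (x : Vector n) f → dot (s ⊙ x) f ≡ s * dot x f
  dot-⊙ s []       f = sym (zeroʳ s)
  dot-⊙ s (x ∷ xs) f = trans (cong₂ _+_ (*-assoc s x _) (dot-⊙ s xs _)) (sym (distribˡ s _ _))

  dot-0v : ∀ {n} f → dot (0v n) f ≡ 0#
  dot-0v {zero}  f = refl
  dot-0v {suc n} f = trans (cong₂ _+_ (zeroˡ _) (dot-0v {n} _)) (+-identityʳ 0#)

  dot-+ : ∀ {n} (x : Vector n) f g → dot x (λ i → f i + g i) ≡ dot x f + dot x g
  dot-+ []       f g = sym (+-identityʳ 0#)
  dot-+ (x ∷ xs) f g = trans (cong₂ _+_ (distribˡ x _ _) (dot-+ xs _ _)) (interchange _ _ _ _)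

  dot-* : ∀ {n} (x : Vector n) s f → dot x (λ i → s * f i) ≡ s * dot x f
  dot-* []       s f = sym (zeroʳ s)
  dot-* (x ∷ xs) s f = trans (cong₂ _+_ (x*yz≡y*xz x s _) (dot-* xs s _)) (sym (distribˡ s _ _))

  dot-0 : ∀ {n} (x : Vector n) → dot x (λ _ → 0#) ≡ 0#
  dot-0 []       = refl
  dot-0 (x ∷ xs) = trans (cong₂ _+_ (zeroʳ x) (dot-0 xs)) (+-identityʳ 0#)

  dot-lc : ∀ {m n} (x : Vector m) (b : Fin m → Vector n) f →
           dot (lc x b) f ≡ dot x (λ l → dot (b l) f)
  dot-lc []       b f = dot-0v f
  dot-lc (x ∷ xs) b f = trans (dot-⊕ (x ⊙ b Fin.zero) _ f)
    (cong₂ _+_ (dot-⊙ x (b Fin.zero) f) (dot-lc xs _ f))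

  dot-insertAt : ∀ {n} (y : Vector n) j t f →
                 dot (insertAt y j t) f ≡ t * f j + dot y (λ i → f (punchIn j i))
  dot-insertAt y        Fin.zero    t f = refl
  dot-insertAt (y ∷ ys) (Fin.suc j) t f =
    trans (cong (y * f Fin.zero +_) (dot-insertAt ys j t _)) (x∙yz≈y∙xz _ _ _)

  lc-⊕ : ∀ {m n} (x y : Vector m) (a : Fin m → Vector n) → lc (x ⊕ y) a ≡ lc x a ⊕ lc y a
  lc-⊕ x y a = vec-ext λ j → begin
    lookup (lc (x ⊕ y) a) j                  ≡⟨ lookup-lc (x ⊕ y) a j ⟩
    dot (x ⊕ y) (λ i → lookup (a i) j)        ≡⟨ dot-⊕ x y _ ⟩
    dot x _ + dot y _                         ≡⟨ sym (cong₂ _+_ (lookup-lc x a j) (lookup-lc y a j)) ⟩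
    lookup (lc x a) j + lookup (lc y a) j     ≡⟨ sym (lookup-⊕ (lc x a) (lc y a) j) ⟩
    lookup (lc x a ⊕ lc y a) j                ∎

  lc-⊙ : ∀ {m n} s (x : Vector m) (a : Fin m → Vector n) → lc (s ⊙ x) a ≡ s ⊙ lc x a
  lc-⊙ s x a = vec-ext λ j → begin
    lookup (lc (s ⊙ x) a) j            ≡⟨ lookup-lc (s ⊙ x) a j ⟩
    dot (s ⊙ x) (λ i → lookup (a i) j)  ≡⟨ dot-⊙ s x _ ⟩
    s * dot x _                         ≡⟨ cong (s *_) (sym (lookup-lc x a j)) ⟩
    s * lookup (lc x a) j               ≡⟨ sym (lookup-⊙ s (lc x a) j) ⟩
    lookup (s ⊙ lc x a) j               ∎

  lc-⊖ : ∀ {m n} (x y : Vector m) (a : Fin m → Vector n) → lc (x ⊖ y) a ≡ lc x a ⊖ lc y a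
  lc-⊖ x y a = trans (lc-⊕ x _ a) (cong (lc x a ⊕_) (lc-⊙ (- 1#) y a))

  lc-cong : ∀ {m n} (x : Vector m) {a b : Fin m → Vector n} → (∀ i → a i ≡ b i) → lc x a ≡ lc x b
  lc-cong x {a} {b} eq = vec-ext λ j → trans (lookup-lc x a j)
    (trans (dot-cong x (λ i → cong (λ v → lookup v j) (eq i))) (sym (lookup-lc x b j)))

  lc-0 : ∀ {m n} (x : Vector m) → lc x (λ _ → 0v n) ≡ 0v n
  lc-0 x = vec-ext λ j → trans (lookup-lc x _ j)
    (trans (dot-cong x (λ _ → lookup-0v j)) (trans (dot-0 x) (sym (lookup-0v j))))

  lc-lc : ∀ {m p n} (x : Vector m) (b : Fin m → Vector p) (a : Fin p → Vector n) →
          lc x (λ l → lc (b l) a) ≡ lc (lc x b) a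
  lc-lc x b a = vec-ext λ j → begin
    lookup (lc x (λ l → lc (b l) a)) j                   ≡⟨ lookup-lc x _ j ⟩
    dot x (λ l → lookup (lc (b l) a) j)                   ≡⟨ dot-cong x (λ l → lookup-lc (b l) a j) ⟩
    dot x (λ l → dot (b l) (λ i → lookup (a i) j))        ≡⟨ sym (dot-lc x b _) ⟩
    dot (lc x b) (λ i → lookup (a i) j)                   ≡⟨ sym (lookup-lc (lc x b) a j) ⟩
    lookup (lc (lc x b) a) j                              ∎

  lc-insertAt : ∀ {m n} (y : Vector m) j t (a : Fin (suc m) → Vector n) →
                lc (insertAt y j t) a ≡ t ⊙ a j ⊕ lc y (λ i → a (punchIn j i))
  lc-insertAt y j t a = vec-ext λ l → begin
    lookup (lc (insertAt y j t) a) l                       ≡⟨ lookup-lc (insertAt y j t) a l ⟩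
    dot (insertAt y j t) (λ i → lookup (a i) l)             ≡⟨ dot-insertAt y j t _ ⟩
    t * lookup (a j) l + dot y _                      ≡⟨ sym (cong₂ _+_ (lookup-⊙ t (a j) l) (lookup-lc y _ l)) ⟩
    lookup (t ⊙ a j) l + lookup (lc y _) l                  ≡⟨ sym (lookup-⊕ (t ⊙ a j) _ l) ⟩
    lookup (t ⊙ a j ⊕ lc y (λ i → a (punchIn j i))) l       ∎

  unit : ∀ {n} → Fin n → Vector n
  unit {suc n} Fin.zero    = 1# ∷ 0v n
  unit {suc n} (Fin.suc i) = 0# ∷ unit i

  lookup-unit-≡ : ∀ {n} (i : Fin n) → lookup (unit i) i ≡ 1#
  lookup-unit-≡ Fin.zero    = refl
  lookup-unit-≡ (Fin.suc i) = lookup-unit-≡ i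

  lookup-unit-≢ : ∀ {n} {i j : Fin n} → i ≢ j → lookup (unit j) i ≡ 0#
  lookup-unit-≢ {i = Fin.zero}  {Fin.zero}  i≢j = ⊥-elim (i≢j refl)
  lookup-unit-≢ {i = Fin.zero}  {Fin.suc j} i≢j = refl
  lookup-unit-≢ {i = Fin.suc i} {Fin.zero}  i≢j = lookup-0v i
  lookup-unit-≢ {i = Fin.suc i} {Fin.suc j} i≢j = lookup-unit-≢ (i≢j ∘ cong Fin.suc)

  dot-unitˡ : ∀ {n} (i : Fin n) f → dot (unit i) f ≡ f i
  dot-unitˡ {suc n} Fin.zero    f = trans (cong₂ _+_ (*-identityˡ _) (dot-0v {n} _)) (+-identityʳ _)
  dot-unitˡ {suc n} (Fin.suc i) f = trans (cong₂ _+_ (zeroˡ _) (dot-unitˡ i _)) (+-identityˡ _)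

  dot-unitʳ : ∀ {n} (x : Vector n) j → dot x (λ i → lookup (unit i) j) ≡ lookup x j
  dot-unitʳ (x ∷ xs) Fin.zero    = trans (cong₂ _+_ (*-identityʳ x) (dot-0 xs)) (+-identityʳ x)
  dot-unitʳ (x ∷ xs) (Fin.suc j) =
    trans (cong₂ _+_ (trans (cong (x *_) (lookup-0v j)) (zeroʳ x)) (dot-unitʳ xs j)) (+-identityˡ _)

  lc-unitˡ : ∀ {m n} (i : Fin m) (a : Fin m → Vector n) → lc (unit i) a ≡ a i
  lc-unitˡ i a = vec-ext λ j → trans (lookup-lc (unit i) a j) (dot-unitˡ i _)

  lc-unitʳ : ∀ {n} (x : Vector n) → lc x unit ≡ x
  lc-unitʳ x = vec-ext λ j → trans (lookup-lc x unit j) (dot-unitʳ x j)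

  record IsLinearFunctional {n} (s : Vector n → Carrier) : Set where
    field
      +-homo : ∀ u v → s (u ⊕ v) ≡ s u + s v
      *-homo : ∀ c u → s (c ⊙ u) ≡ c * s u

  record IsLinear {n p} (φ : Vector n → Vector p) : Set where
    field
      ⊕-homo : ∀ u v → φ (u ⊕ v) ≡ φ u ⊕ φ v
      ⊙-homo : ∀ s u → φ (s ⊙ u) ≡ s ⊙ φ u

  dot-isLinearFunctional : ∀ {n} (ρ : Fin n → Carrier) → IsLinearFunctional (λ y → dot y ρ)
  dot-isLinearFunctional ρ = record { +-homo = λ u v → dot-⊕ u v ρ ; *-homo = λ c u → dot-⊙ c u ρ }

  lookup-isLinearFunctional : ∀ {n} (j : Fin n) → IsLinearFunctional (λ y → lookup y j)
  lookup-isLinearFunctional j = record { +-homo = λ u v → lookup-⊕ u v j ; *-homo = λ c u → lookup-⊙ c u j }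

  *-isLinearFunctional : ∀ {n} c {s : Vector n → Carrier} → IsLinearFunctional s →
                         IsLinearFunctional (λ y → c * s y)
  *-isLinearFunctional c {s} linear = record
    { +-homo = λ u v → trans (cong (c *_) (+-homo u v)) (distribˡ c _ _)
    ; *-homo = λ d u → trans (cong (c *_) (*-homo d u)) (x*yz≡y*xz c d (s u))
    }
    where open IsLinearFunctional linear

  ∘-isLinear : ∀ {n p r} {ψ : Vector p → Vector r} {φ : Vector n → Vector p} →
               IsLinear ψ → IsLinear φ → IsLinear (ψ ∘ φ)
  ∘-isLinear {ψ = ψ} {φ} ψ-linear φ-linear = record
    { ⊕-homo = λ u v → trans (cong ψ (Φ.⊕-homo u v)) (Ψ.⊕-homo (φ u) (φ v))
    ; ⊙-homo = λ s u → trans (cong ψ (Φ.⊙-homo s u)) (Ψ.⊙-homo s (φ u))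
    }
    where
    module Ψ = IsLinear ψ-linear
    module Φ = IsLinear φ-linear

  update-isLinear : ∀ {n} (g : Vector n) {s : Vector n → Carrier} → IsLinearFunctional s →
                    IsLinear (λ y → y ⊕ s y ⊙ g)
  update-isLinear g {s} linear = record
    { ⊕-homo = λ u v → vec-ext λ i → let gᵢ = lookup g i in begin
        lookup (u ⊕ v ⊕ s (u ⊕ v) ⊙ g) i
          ≡⟨ lookup-⊕⊙ (u ⊕ v) _ g i ⟩
        lookup (u ⊕ v) i + s (u ⊕ v) * gᵢ
          ≡⟨ cong₂ (λ a b → a + b * gᵢ) (lookup-⊕ u v i) (+-homo u v) ⟩
        (lookup u i + lookup v i) + (s u + s v) * gᵢ
          ≡⟨ cong (lookup u i + lookup v i +_) (distribʳ gᵢ (s u) (s v)) ⟩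
        (lookup u i + lookup v i) + (s u * gᵢ + s v * gᵢ)
          ≡⟨ interchange _ _ _ _ ⟩
        (lookup u i + s u * gᵢ) + (lookup v i + s v * gᵢ)
          ≡⟨ sym (cong₂ _+_ (lookup-⊕⊙ u _ g i) (lookup-⊕⊙ v _ g i)) ⟩
        lookup (u ⊕ s u ⊙ g) i + lookup (v ⊕ s v ⊙ g) i
          ≡⟨ sym (lookup-⊕ (u ⊕ s u ⊙ g) (v ⊕ s v ⊙ g) i) ⟩
        lookup ((u ⊕ s u ⊙ g) ⊕ (v ⊕ s v ⊙ g)) i
          ∎
    ; ⊙-homo = λ c u → vec-ext λ i → let gᵢ = lookup g i in begin
        lookup (c ⊙ u ⊕ s (c ⊙ u) ⊙ g) i  ≡⟨ lookup-⊕⊙ (c ⊙ u) _ g i ⟩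
        lookup (c ⊙ u) i + s (c ⊙ u) * gᵢ ≡⟨ cong₂ (λ a b → a + b * gᵢ) (lookup-⊙ c u i) (*-homo c u) ⟩
        c * lookup u i + (c * s u) * gᵢ   ≡⟨ cong (c * lookup u i +_) (*-assoc c (s u) gᵢ) ⟩
        c * lookup u i + c * (s u * gᵢ)   ≡⟨ sym (distribˡ c _ _) ⟩
        c * (lookup u i + s u * gᵢ)       ≡⟨ cong (c *_) (sym (lookup-⊕⊙ u _ g i)) ⟩
        c * lookup (u ⊕ s u ⊙ g) i        ≡⟨ sym (lookup-⊙ c (u ⊕ s u ⊙ g) i) ⟩
        lookup (c ⊙ (u ⊕ s u ⊙ g)) i      ∎
    }
    where open IsLinearFunctional linear

  insertAt-⊕ : ∀ {n} (u v : Vector n) j a b → insertAt (u ⊕ v) j (a + b) ≡ insertAt u j a ⊕ insertAt v j b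
  insertAt-⊕ u       v       Fin.zero    a b = refl
  insertAt-⊕ (x ∷ u) (y ∷ v) (Fin.suc j) a b = cong (x + y ∷_) (insertAt-⊕ u v j a b)

  insertAt-⊙ : ∀ {n} s (u : Vector n) j a → insertAt (s ⊙ u) j (s * a) ≡ s ⊙ insertAt u j a
  insertAt-⊙ s u       Fin.zero    a = refl
  insertAt-⊙ s (x ∷ u) (Fin.suc j) a = cong (s * x ∷_) (insertAt-⊙ s u j a)

  insertAt-0v : ∀ {n} (j : Fin (suc n)) → insertAt (0v n) j 0# ≡ 0v (suc n)
  insertAt-0v         Fin.zero    = refl
  insertAt-0v {suc n} (Fin.suc j) = cong (0# ∷_) (insertAt-0v j)

  insertAt-isLinear : ∀ {n} (j : Fin (suc n)) {t : Vector n → Carrier} → IsLinearFunctional t →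
                      IsLinear (λ y → insertAt y j (t y))
  insertAt-isLinear j {t} linear = record
    { ⊕-homo = λ u v → trans (cong (insertAt (u ⊕ v) j) (+-homo u v)) (insertAt-⊕ u v j (t u) (t v))
    ; ⊙-homo = λ s u → trans (cong (insertAt (s ⊙ u) j) (*-homo s u)) (insertAt-⊙ s u j (t u))
    }
    where open IsLinearFunctional linear

  removeAt-isLinear : ∀ {n} (j : Fin (suc n)) → IsLinear (λ y → removeAt y j)
  removeAt-isLinear j = record { ⊕-homo = ⊕-homo j ; ⊙-homo = λ s u → ⊙-homo s u j }
    where
    ⊕-homo : ∀ {n} (j : Fin (suc n)) (u v : Vector (suc n)) →
             removeAt (u ⊕ v) j ≡ removeAt u j ⊕ removeAt v j
    ⊕-homo         Fin.zero    (x ∷ u)         (y ∷ v)         = refl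
    ⊕-homo {suc n} (Fin.suc j) (x ∷ u@(_ ∷ _)) (y ∷ v@(_ ∷ _)) = cong (x + y ∷_) (⊕-homo j u v)
    ⊙-homo : ∀ {n} s (u : Vector (suc n)) (j : Fin (suc n)) → removeAt (s ⊙ u) j ≡ s ⊙ removeAt u j
    ⊙-homo         s (x ∷ u)         Fin.zero    = refl
    ⊙-homo {suc n} s (x ∷ u@(_ ∷ _)) (Fin.suc j) = cong (s * x ∷_) (⊙-homo s u j)

  module _ {n p} {φ : Vector n → Vector p} (linear : IsLinear φ) where
    open IsLinear linear

    linear-0v : φ (0v n) ≡ 0v p
    linear-0v = begin
      φ (0v n)          ≡⟨ cong φ (sym (0#⊙ (0v n))) ⟩
      φ (0# ⊙ 0v n)     ≡⟨ ⊙-homo 0# (0v n) ⟩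
      0# ⊙ φ (0v n)     ≡⟨ 0#⊙ _ ⟩
      0v p              ∎

    linear-⊖ : ∀ u v → φ (u ⊖ v) ≡ φ u ⊖ φ v
    linear-⊖ u v = trans (⊕-homo u _) (cong (φ u ⊕_) (⊙-homo (- 1#) v))

    linear-lc : ∀ {m} (c : Vector m) (a : Fin m → Vector n) → φ (lc c a) ≡ lc c (φ ∘ a)
    linear-lc []       a = linear-0v
    linear-lc (c ∷ cs) a =
      trans (⊕-homo _ _) (cong₂ _⊕_ (⊙-homo c (a Fin.zero)) (linear-lc cs (a ∘ Fin.suc)))

  columns : ∀ {n p r} → (Vector n → Vector p) → (Fin p → Vector r) → Fin n → Vector r
  columns φ K l = lc (φ (unit l)) K

  lc-columns : ∀ {n p r} {φ : Vector n → Vector p} → IsLinear φ → (K : Fin p → Vector r) (x : Vector n) →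
               lc x (columns φ K) ≡ lc (φ x) K
  lc-columns {φ = φ} linear K x = begin
    lc x (λ l → lc (φ (unit l)) K)   ≡⟨ lc-lc x (φ ∘ unit) K ⟩
    lc (lc x (φ ∘ unit)) K           ≡⟨ cong (λ w → lc w K) (sym (linear-lc linear x unit)) ⟩
    lc (φ (lc x unit)) K             ≡⟨ cong (λ w → lc (φ w) K) (lc-unitʳ x) ⟩
    lc (φ x) K                       ∎

  hyperplane-chart : ∀ {n} (ρ : Fin (suc n) → Carrier) {j} → ρ j ≢ 0# →
    Σ (Vector n → Vector (suc n)) λ ψ →
      IsLinear ψ × (∀ y → removeAt (ψ y) j ≡ y) × (∀ y → dot (ψ y) ρ ≡ 0#)
  hyperplane-chart ρ {j} ρⱼ≢0 =
    ψ , insertAt-isLinear j (*-isLinearFunctional (- u) (dot-isLinearFunctional (ρ ∘ punchIn j)))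
      , (λ y → removeAt-insertAt y j (t y)) , ψ-in-hyperplane
    where
    u = proj₁ (inverse (ρ j) ρⱼ≢0)
    t : Vector _ → Carrier
    t y = - u * dot y (ρ ∘ punchIn j)
    ψ : Vector _ → Vector _
    ψ y = insertAt y j (t y)
    ψ-in-hyperplane : ∀ y → dot (ψ y) ρ ≡ 0#
    ψ-in-hyperplane y = begin
      dot (ψ y) ρ          ≡⟨ dot-insertAt y j (t y) ρ ⟩
      (- u * D) * ρ j + D  ≡⟨ cong (_+ D) (-u*x*a≡-x (proj₂ (inverse (ρ j) ρⱼ≢0)) D) ⟩
      - D + D              ≡⟨ -‿inverseˡ D ⟩
      0#                   ∎
      where D = dot y (ρ ∘ punchIn j)

  y⊕c⊙g≡0⇒y≡-c⊙g : ∀ {n} {y g : Vector n} c → y ⊕ c ⊙ g ≡ 0v n → y ≡ (- c) ⊙ g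
  y⊕c⊙g≡0⇒y≡-c⊙g {y = y} {g} c eq = vec-ext λ i → begin
    lookup y i              ≡⟨ +-inverseˡ-unique _ _ (trans (sym (lookup-⊕⊙ y c g i))
                                                      (trans (cong (λ w → lookup w i) eq) (lookup-0v i))) ⟩
    - (c * lookup g i)      ≡⟨ -‿distribˡ-* c _ ⟩
    - c * lookup g i        ≡⟨ sym (lookup-⊙ (- c) g i) ⟩
    lookup ((- c) ⊙ g) i    ∎

  quotient-by-line : ∀ {n} (g : Vector (suc n)) {j} → lookup g j ≢ 0# →
    Σ (Vector (suc n) → Vector n) λ φ → IsLinear φ × (∀ y → φ y ≡ 0v n → ∃ λ s → y ≡ s ⊙ g)
  quotient-by-line {n} g {j} gⱼ≢0 =
    (λ y → removeAt (clear y) j) ,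
    ∘-isLinear (removeAt-isLinear j)
      (update-isLinear g (*-isLinearFunctional (- u) (lookup-isLinearFunctional j))) ,
    kernel
    where
    u = proj₁ (inverse (lookup g j) gⱼ≢0)
    s : Vector (suc n) → Carrier
    s y = - u * lookup y j
    clear : Vector (suc n) → Vector (suc n)
    clear y = y ⊕ s y ⊙ g
    clear-j : ∀ y → lookup (clear y) j ≡ 0#
    clear-j y = begin
      lookup (clear y) j                  ≡⟨ lookup-⊕⊙ y (s y) g j ⟩
      lookup y j + s y * lookup g j  ≡⟨ cong (lookup y j +_) (-u*x*a≡-x (proj₂ (inverse (lookup g j) gⱼ≢0)) _) ⟩
      lookup y j + - lookup y j           ≡⟨ -‿inverseʳ (lookup y j) ⟩
      0#                                  ∎
    kernel : ∀ y → removeAt (clear y) j ≡ 0v n → ∃ λ c → y ≡ c ⊙ g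
    kernel y eq = - s y , y⊕c⊙g≡0⇒y≡-c⊙g (s y) (begin
      clear y                                                 ≡⟨ sym (insertAt-removeAt (clear y) j) ⟩
      insertAt (removeAt (clear y) j) j (lookup (clear y) j)  ≡⟨ cong₂ (λ z w → insertAt z j w) eq (clear-j y) ⟩
      insertAt (0v n) j 0#                                    ≡⟨ insertAt-0v j ⟩
      0v (suc n)                                              ∎)

  Independent : ∀ {k n} → (Fin k → Vector n) → Set
  Independent {k} {n} b = (c : Vector k) → lc c b ≡ 0v n → ∀ i → lookup c i ≡ 0#

  lc-0∷ : ∀ {m n} (x : Vector m) (b : Fin m → Vector n) → lc x (λ i → 0# ∷ b i) ≡ 0# ∷ lc x b
  lc-0∷ []       b = refl
  lc-0∷ (x ∷ xs) b = trans (cong (x ⊙ (0# ∷ b Fin.zero) ⊕_) (lc-0∷ xs (b ∘ Fin.suc)))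
    (cong (_∷ x ⊙ b Fin.zero ⊕ lc xs (b ∘ Fin.suc)) (trans (+-identityʳ _) (zeroʳ x)))

  standard : ∀ {k n} → k ≤ n → Fin k → Vector n
  standard (s≤s k≤n) Fin.zero    = 1# ∷ 0v _
  standard (s≤s k≤n) (Fin.suc i) = 0# ∷ standard k≤n i

  lc-standard : ∀ {k n} (k≤n : k ≤ n) c (cs : Vector k) →
                lc (c ∷ cs) (standard (s≤s k≤n)) ≡ c ∷ lc cs (standard k≤n)
  lc-standard {n = n} k≤n c cs = begin
    c ⊙ (1# ∷ 0v n) ⊕ lc cs (λ i → 0# ∷ standard k≤n i)
      ≡⟨ cong (c ⊙ (1# ∷ 0v n) ⊕_) (lc-0∷ cs (standard k≤n)) ⟩
    c * 1# + 0# ∷ c ⊙ 0v n ⊕ lc cs (standard k≤n)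
      ≡⟨ cong₂ _∷_ (trans (+-identityʳ _) (*-identityʳ c)) (trans (cong (_⊕ _) (⊙0v c)) (0v⊕ _)) ⟩
    c ∷ lc cs (standard k≤n)
      ∎

  standard-independent : ∀ {k n} (k≤n : k ≤ n) → Independent (standard k≤n)
  standard-independent (s≤s k≤n) (c ∷ cs) eq Fin.zero    =
    ∷-injectiveˡ (trans (sym (lc-standard k≤n c cs)) eq)
  standard-independent (s≤s k≤n) (c ∷ cs) eq (Fin.suc i) =
    standard-independent k≤n cs (∷-injectiveʳ (trans (sym (lc-standard k≤n c cs)) eq)) i

  lookup-lc-suc : ∀ {m n} (x : Vector m) (a : Fin m → Vector (suc n)) r →
                  lookup (lc x a) (Fin.suc r) ≡ lookup (lc x (tail ∘ a)) r
  lookup-lc-suc x a r = trans (lookup-lc x a (Fin.suc r))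
    (trans (dot-cong x (λ i → lookup-suc (a i) r)) (sym (lookup-lc x (tail ∘ a) r)))
    where
    lookup-suc : ∀ {n} (v : Vector (suc n)) r → lookup v (Fin.suc r) ≡ lookup (tail v) r
    lookup-suc (_ ∷ _) r = refl

  kernel-family : ∀ m {n k} → m +ℕ k ≤ n → (H : Fin n → Vector m) →
                  Σ (Fin k → Vector n) λ B → Independent B × (∀ i → lc (B i) H ≡ 0v m)
  kernel-family zero    k≤n H = standard k≤n , standard-independent k≤n , λ _ → vec-ext λ ()
  kernel-family (suc m) m+k<n H with any? (λ j → ¬? (lookup (H j) Fin.zero ≟ 0#))
  kernel-family (suc m) {suc n} m+k<n H | yes (j , pivot) = ψ ∘ B , independent , relation
    where
    chart = hyperplane-chart (λ j → lookup (H j) Fin.zero) pivot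
    ψ = proj₁ chart
    ψ-linear = proj₁ (proj₂ chart)
    rec = kernel-family m (ℕₚ.≤-pred m+k<n) (tail ∘ columns ψ H)
    B = proj₁ rec
    independent : Independent (ψ ∘ B)
    independent c eq = proj₁ (proj₂ rec) c (begin
      lc c B                       ≡⟨ sym (proj₁ (proj₂ (proj₂ chart)) (lc c B)) ⟩
      removeAt (ψ (lc c B)) j      ≡⟨ cong (λ w → removeAt w j) (trans (linear-lc ψ-linear c B) eq) ⟩
      removeAt (0v (suc n)) j      ≡⟨ linear-0v (removeAt-isLinear j) ⟩
      0v n                         ∎)
    relation : ∀ i → lc (ψ (B i)) H ≡ 0v (suc m)
    relation i = vec-ext λ
      { Fin.zero    → trans (lookup-lc (ψ (B i)) H Fin.zero) (proj₂ (proj₂ (proj₂ chart)) (B i))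
      ; (Fin.suc r) → begin
        lookup (lc (ψ (B i)) H) (Fin.suc r)
          ≡⟨ cong (λ w → lookup w (Fin.suc r)) (sym (lc-columns ψ-linear H (B i))) ⟩
        lookup (lc (B i) (columns ψ H)) (Fin.suc r) ≡⟨ lookup-lc-suc (B i) (columns ψ H) r ⟩
        lookup (lc (B i) (tail ∘ columns ψ H)) r   ≡⟨ cong (λ w → lookup w r) (proj₂ (proj₂ rec) i) ⟩
        lookup (0v m) r                            ∎
      }
  kernel-family (suc m) {zero} m+k<n H | yes (() , _)
  kernel-family (suc m) m+k<n H | no no-pivot = B , proj₁ (proj₂ rec) , relation
    where
    rec = kernel-family m (ℕₚ.<⇒≤ m+k<n) (tail ∘ H)
    B = proj₁ rec
    head-zero : ∀ j → lookup (H j) Fin.zero ≡ 0#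
    head-zero j with lookup (H j) Fin.zero ≟ 0#
    ... | yes eq  = eq
    ... | no  neq = ⊥-elim (no-pivot (j , neq))
    relation : ∀ i → lc (B i) H ≡ 0v (suc m)
    relation i = vec-ext λ
      { Fin.zero    → trans (lookup-lc (B i) H Fin.zero) (trans (dot-cong (B i) head-zero) (dot-0 (B i)))
      ; (Fin.suc r) → trans (lookup-lc-suc (B i) H r) (cong (λ w → lookup w r) (proj₂ (proj₂ rec) i))
      }

  independent⇒nonzero : ∀ {k n} {b : Fin k → Vector n} → Independent b → ∀ i → b i ≢ 0v n
  independent⇒nonzero {b = b} independent i bᵢ≡0 =
    1≢0 (trans (sym (lookup-unit-≡ i)) (independent (unit i) (trans (lc-unitˡ i b) bᵢ≡0) i))

  parity-check : ∀ k {n} (g : Fin k → Vector n) → Independent g →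
    Σ (Fin n → Vector (n ∸ k)) λ H → ∀ x → lc x H ≡ 0v (n ∸ k) → ∃ λ c → lc c g ≡ x
  parity-check zero    g _ = unit , λ x x∈ker → [] , trans (sym x∈ker) (lc-unitʳ x)
  parity-check (suc k) {n} g independent
    with nonzero-coordinate (g Fin.zero) (independent⇒nonzero independent Fin.zero)
  parity-check (suc k) {zero}  g independent | () , _
  parity-check (suc k) {suc n} g independent | j , gⱼ≢0 = columns φ H , in-span
    where
    quotient = quotient-by-line (g Fin.zero) gⱼ≢0
    φ = proj₁ quotient
    φ-linear = proj₁ (proj₂ quotient)
    φ-kernel = proj₂ (proj₂ quotient)
    independent′ : Independent (φ ∘ g ∘ Fin.suc)
    independent′ c eq i = independent ((- s) ∷ c) relation (Fin.suc i)
      where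
      line = φ-kernel (lc c (g ∘ Fin.suc)) (trans (linear-lc φ-linear c _) eq)
      s = proj₁ line
      relation : (- s) ⊙ g Fin.zero ⊕ lc c (g ∘ Fin.suc) ≡ 0v (suc n)
      relation = trans (cong ((- s) ⊙ g Fin.zero ⊕_) (proj₂ line)) (-c⊙v⊕c⊙v≡0v s (g Fin.zero))
    rec = parity-check k (φ ∘ g ∘ Fin.suc) independent′
    H = proj₁ rec
    in-span : ∀ x → lc x (columns φ H) ≡ 0v (n ∸ k) → ∃ λ c → lc c g ≡ x
    in-span x eq = s ∷ c , u⊖v≡w⇒w⊕v≡u (proj₂ line)
      where
      preimage = proj₂ rec (φ x) (trans (sym (lc-columns φ-linear H x)) eq)
      c = proj₁ preimage
      L = lc c (g ∘ Fin.suc)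
      line = φ-kernel (x ⊖ L) (begin
        φ (x ⊖ L)    ≡⟨ linear-⊖ φ-linear x L ⟩
        φ x ⊖ φ L    ≡⟨ cong (φ x ⊖_) (trans (linear-lc φ-linear c _) (proj₂ preimage)) ⟩
        φ x ⊖ φ x    ≡⟨ ⊖-self (φ x) ⟩
        0v n         ∎)
      s = proj₁ line

  wt₁ : Carrier → ℕ
  wt₁ x with x ≟ 0#
  ... | yes _ = 0
  ... | no  _ = 1

  wt₁-0 : ∀ {x} → x ≡ 0# → wt₁ x ≡ 0
  wt₁-0 {x} x≡0 with x ≟ 0#
  ... | yes _   = refl
  ... | no  x≢0 = ⊥-elim (x≢0 x≡0)

  wt₁-1 : ∀ {x} → x ≢ 0# → wt₁ x ≡ 1
  wt₁-1 {x} x≢0 with x ≟ 0#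
  ... | yes x≡0 = ⊥-elim (x≢0 x≡0)
  ... | no  _   = refl

  wt₁≡0⇒≡0 : ∀ {x} → wt₁ x ≡ 0 → x ≡ 0#
  wt₁≡0⇒≡0 {x} eq with x ≟ 0#
  ... | yes x≡0 = x≡0
  ... | no  _   = ⊥-elim (ℕₚ.1+n≢0 eq)

  wt-∷ : ∀ {n} x (xs : Vector n) → wt (x ∷ xs) ≡ wt₁ x +ℕ wt xs
  wt-∷ x xs with x ≟ 0#
  ... | yes _ = refl
  ... | no  _ = refl

  wt≤n : ∀ {n} (v : Vector n) → wt v ≤ n
  wt≤n = count≤n _

  wt-0v : ∀ n → wt (0v n) ≡ 0
  wt-0v zero    = refl
  wt-0v (suc n) = trans (wt-∷ 0# (0v n)) (cong₂ _+ℕ_ (wt₁-0 refl) (wt-0v n))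

  wt-unit : ∀ {n} (i : Fin n) → wt (unit i) ≡ 1
  wt-unit {suc n} Fin.zero    = trans (wt-∷ 1# (0v n)) (cong₂ _+ℕ_ (wt₁-1 1≢0) (wt-0v n))
  wt-unit {suc n} (Fin.suc i) = trans (wt-∷ 0# (unit i)) (cong₂ _+ℕ_ (wt₁-0 refl) (wt-unit i))

  wt-insertAt : ∀ {n} (x : Vector n) j b → wt (insertAt x j b) ≡ wt₁ b +ℕ wt x
  wt-insertAt x        Fin.zero    b = wt-∷ b x
  wt-insertAt (x ∷ xs) (Fin.suc j) b = begin
    wt (x ∷ insertAt xs j b)           ≡⟨ wt-∷ x (insertAt xs j b) ⟩
    wt₁ x +ℕ wt (insertAt xs j b)      ≡⟨ cong (wt₁ x +ℕ_) (wt-insertAt xs j b) ⟩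
    wt₁ x +ℕ (wt₁ b +ℕ wt xs)          ≡⟨ x+[y+z]≡y+[x+z] (wt₁ x) (wt₁ b) (wt xs) ⟩
    wt₁ b +ℕ (wt₁ x +ℕ wt xs)          ≡⟨ cong (wt₁ b +ℕ_) (sym (wt-∷ x xs)) ⟩
    wt₁ b +ℕ wt (x ∷ xs)               ∎

  wt₁≤1 : ∀ x → wt₁ x ≤ 1
  wt₁≤1 x with x ≟ 0#
  ... | yes _ = z≤n
  ... | no  _ = s≤s z≤n

  wt₁-⊖ : ∀ x y → wt₁ (x + - 1# * y) ≤ wt₁ x +ℕ wt₁ y
  wt₁-⊖ x y with x ≟ 0# | y ≟ 0#
  ... | yes x≡0 | yes y≡0 = ℕₚ.≤-reflexive (wt₁-0 (begin
    x + - 1# * y   ≡⟨ cong₂ (λ a b → a + - 1# * b) x≡0 y≡0 ⟩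
    0# + - 1# * 0# ≡⟨ +-identityˡ _ ⟩
    - 1# * 0#      ≡⟨ zeroʳ _ ⟩
    0#             ∎))
  ... | yes _ | no _ = wt₁≤1 _
  ... | no  _ | _    = ℕₚ.m≤n⇒m≤n+o _ (wt₁≤1 _)

  wt-⊖ : ∀ {n} (u v : Vector n) → wt (u ⊖ v) ≤ wt u +ℕ wt v
  wt-⊖ []      []      = z≤n
  wt-⊖ (x ∷ u) (y ∷ v) = subst (_≤ wt (x ∷ u) +ℕ wt (y ∷ v)) (sym (wt-∷ (x + - 1# * y) (u ⊖ v)))
    (subst (wt₁ (x + - 1# * y) +ℕ wt (u ⊖ v) ≤_) regroup (ℕₚ.+-mono-≤ (wt₁-⊖ x y) (wt-⊖ u v)))
    where
    regroup : (wt₁ x +ℕ wt₁ y) +ℕ (wt u +ℕ wt v) ≡ wt (x ∷ u) +ℕ wt (y ∷ v)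
    regroup = trans (x+y+[z+w]≡x+z+[y+w] (wt₁ x) (wt₁ y) (wt u) (wt v))
                    (sym (cong₂ _+ℕ_ (wt-∷ x u) (wt-∷ y v)))

  record Difference {N} (Y : Vector N) (s t : ℕ) : Set where
    field
      c c′   : Vector N
      c≡Y+c′ : ∀ l → lookup c l ≡ lookup Y l + lookup c′ l
      wt-c   : wt c ≡ s
      wt-c′  : wt c′ ≡ t

  Difference-∷ : ∀ {N y} {ys : Vector N} {s t} a a′ {i i′} → a ≡ y + a′ → wt₁ a ≡ i → wt₁ a′ ≡ i′ →
                 Difference ys s t → Difference (y ∷ ys) (i +ℕ s) (i′ +ℕ t)
  Difference-∷ a a′ a≡y+a′ wt-a wt-a′ D = record
    { c      = a ∷ c
    ; c′     = a′ ∷ c′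
    ; c≡Y+c′ = λ { Fin.zero → a≡y+a′ ; (Fin.suc l) → c≡Y+c′ l }
    ; wt-c   = trans (wt-∷ a c) (cong₂ _+ℕ_ wt-a wt-c)
    ; wt-c′  = trans (wt-∷ a′ c′) (cong₂ _+ℕ_ wt-a′ wt-c′)
    }
    where open Difference D

  -- every nonzero y is the difference (y + p y) − p y of two nonzero elements
  NonzeroSplitting : Set
  NonzeroSplitting = Σ (Carrier → Carrier) λ p → ∀ y → y ≢ 0# → p y ≢ 0# × y + p y ≢ 0#

  -- On the support of Y, c and c′ are both nonzero at b coordinates, only c at p and only c′ at p′ of them;
  -- both equal 1 at z coordinates outside the support. (Matching on y ≟ 0# also unfolds wt (y ∷ ys).)
  split : ∀ {N} (Y : Vector N) b p p′ z → b ≡ 0 ⊎ NonzeroSplitting →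
          wt Y ≡ b +ℕ p +ℕ p′ → z +ℕ wt Y ≤ N → Difference Y (b +ℕ p +ℕ z) (b +ℕ p′ +ℕ z)
  split []       0       0       0        0       _ _  _  =
    record { c = [] ; c′ = [] ; c≡Y+c′ = λ () ; wt-c = refl ; wt-c′ = refl }
  split []       (suc b) p       p′       z       _ () _
  split []       0       (suc p) p′       z       _ () _
  split []       0       0       (suc p′) z       _ () _
  split []       0       0       0        (suc z) _ _  ()
  split {suc N} (y ∷ ys) b p p′ z splitting wt≡ room with y ≟ 0#
  split {suc N} (y ∷ ys) b p p′ 0 splitting wt≡ room | yes y≡0 =
    Difference-∷ 0# 0# (sym (trans (+-identityʳ y) y≡0)) (wt₁-0 refl) (wt₁-0 refl)
      (split ys b p p′ 0 splitting wt≡ (wt≤n ys))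
  split {suc N} (y ∷ ys) b p p′ (suc z) splitting wt≡ room | yes y≡0 =
    subst₂ (Difference (y ∷ ys)) (sym (ℕₚ.+-suc (b +ℕ p) z)) (sym (ℕₚ.+-suc (b +ℕ p′) z))
      (Difference-∷ 1# 1# (sym (trans (cong (_+ 1#) y≡0) (+-identityˡ 1#))) (wt₁-1 1≢0) (wt₁-1 1≢0)
        (split ys b p p′ z splitting wt≡ (ℕₚ.≤-pred room)))
  ... | no y≢0 = split-support b p p′ splitting wt≡
    where
    room′ : z +ℕ wt ys ≤ N
    room′ = ℕₚ.≤-pred (subst (_≤ suc N) (ℕₚ.+-suc z (wt ys)) room)
    split-support : ∀ b p p′ → b ≡ 0 ⊎ NonzeroSplitting → suc (wt ys) ≡ b +ℕ p +ℕ p′ →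
                    Difference (y ∷ ys) (b +ℕ p +ℕ z) (b +ℕ p′ +ℕ z)
    split-support (suc b) p p′ (inj₁ ())
    split-support (suc b) p p′ (inj₂ (s , nonzero)) wt≡ =
      Difference-∷ (y + s y) (s y) refl (wt₁-1 (proj₂ (nonzero y y≢0))) (wt₁-1 (proj₁ (nonzero y y≢0)))
        (split ys b p p′ z (inj₂ (s , nonzero)) (ℕₚ.suc-injective wt≡) room′)
    split-support 0 (suc p) p′ _ wt≡ =
      Difference-∷ y 0# (sym (+-identityʳ y)) (wt₁-1 y≢0) (wt₁-0 refl)
        (split ys 0 p p′ z (inj₁ refl) (ℕₚ.suc-injective wt≡) room′)
    split-support 0 0 (suc p′) _ wt≡ =
      Difference-∷ 0# (- y) (sym (-‿inverseʳ y)) (wt₁-0 refl) (wt₁-1 (-‿≢0 y≢0))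
        (split ys 0 0 p′ z (inj₁ refl) (ℕₚ.suc-injective wt≡) room′)

  sₕ-relation-vanishes : ∀ {h N r} {a : Fin N → Vector r} → IsSₕLinearSet F h a →
    ∀ {Y} → lc Y a ≡ 0v r → Difference Y h h → ∀ i → a i ≢ 0v r → lookup Y i ≡ 0#
  sₕ-relation-vanishes {r = r} {a} sₕ {Y} relation D i aᵢ≢0 =
    x+y≡y⇒x≡0 _ _ (trans (sym (c≡Y+c′ i)) (proj₂ (proj₂ (sₕ c c′ wt-c wt-c′ same-value i)) aᵢ≢0))
    where
    open Difference D
    c≡Y⊕c′ : c ≡ Y ⊕ c′
    c≡Y⊕c′ = vec-ext λ l → trans (c≡Y+c′ l) (sym (lookup-⊕ Y c′ l))
    same-value : lc c a ≡ lc c′ a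
    same-value = begin
      lc c a                ≡⟨ cong (λ w → lc w a) c≡Y⊕c′ ⟩
      lc (Y ⊕ c′) a         ≡⟨ lc-⊕ Y c′ a ⟩
      lc Y a ⊕ lc c′ a      ≡⟨ cong (_⊕ lc c′ a) relation ⟩
      0v r ⊕ lc c′ a        ≡⟨ 0v⊕ (lc c′ a) ⟩
      lc c′ a               ∎

  -- Pad Y with equal scalars off its support and split the support evenly between two h-combinations.
  short-relation-vanishes : ∀ {h N r} {a : Fin N → Vector r} → IsSₕLinearSet F h a → h +ℕ h < N →
    ∀ {Y} → lc Y a ≡ 0v r → wt Y ≤ h +ℕ h → Even (wt Y) ⊎ NonzeroSplitting →
    ∀ i → a i ≢ 0v r → lookup Y i ≡ 0#
  short-relation-vanishes {h} {N} sₕ 2h<N {Y} relation short parity =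
    sₕ-relation-vanishes sₕ relation (difference parity)
    where
    room : ∀ A B r → A +ℕ r ≡ h → B ≤ h → r +ℕ (A +ℕ B) ≤ N
    room A B r A+r≡h B≤h =
      ℕₚ.≤-trans (ℕₚ.≤-reflexive (trans (x+[y+z]≡[y+x]+z r A B) (cong (_+ℕ B) A+r≡h)))
        (ℕₚ.≤-trans (ℕₚ.+-monoʳ-≤ h B≤h) (ℕₚ.<⇒≤ 2h<N))
    even-difference : Even (wt Y) → Difference Y h h
    even-difference (A , wt≡A+A) = subst₂ (Difference Y) A+r≡h A+r≡h
      (split Y 0 A A r (inj₁ refl) wt≡A+A
        (subst (λ w → r +ℕ w ≤ N) (sym wt≡A+A) (room A A r A+r≡h A≤h)))
      where
      A≤h = m+m≤n+n⇒m≤n (subst (_≤ h +ℕ h) wt≡A+A short)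
      r = proj₁ (ℕₚ.m≤n⇒∃[o]m+o≡n A≤h)
      A+r≡h = proj₂ (ℕₚ.m≤n⇒∃[o]m+o≡n A≤h)
    difference : Even (wt Y) ⊎ NonzeroSplitting → Difference Y h h
    difference (inj₁ even) = even-difference even
    difference (inj₂ splitting) with even-or-odd (wt Y)
    ... | inj₁ even = even-difference even
    ... | inj₂ (A , wt≡1+A+A) = subst₂ (Difference Y) 1+A+r≡h 1+A+r≡h
      (split Y 1 A A r (inj₂ splitting) wt≡1+A+A
        (subst (λ w → r +ℕ w ≤ N) (sym wt≡1+A+A) (room (suc A) A r 1+A+r≡h (ℕₚ.<⇒≤ A<h))))
      where
      A<h = 1+m+m≤n+n⇒m<n (subst (_≤ h +ℕ h) wt≡1+A+A short)
      r = proj₁ (ℕₚ.m≤n⇒∃[o]m+o≡n A<h)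
      1+A+r≡h = proj₂ (ℕₚ.m≤n⇒∃[o]m+o≡n A<h)

  NoShortRelation : ℕ → ∀ {n m} → (Fin n → Vector m) → Set
  NoShortRelation w {n} {m} H = ∀ x → lc x H ≡ 0v m → wt x ≤ w → x ≡ 0v n

  -- inserting b at z makes x a relation among the elements of a to which short-relation-vanishes applies
  Extension : ∀ {n m} → ℕ → (Fin (suc n) → Vector m) → Fin (suc n) → Vector n → Set
  Extension {m = m} h a z x = ∃ λ b → lc (insertAt x z b) a ≡ 0v m ×
    wt₁ b +ℕ wt x ≤ h +ℕ h × (Even (wt₁ b +ℕ wt x) ⊎ NonzeroSplitting)

  no-short-relation : ∀ {h n m} {a : Fin (suc n) → Vector m} → IsSₕLinearSet F h a → h +ℕ h ≤ n →
    ∀ z → (∀ j → a (punchIn z j) ≢ 0v m) → (H : Fin n → Vector m) →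
    (∀ x → lc x H ≡ 0v m → wt x ≤ h +ℕ h → Extension h a z x) → NoShortRelation (h +ℕ h) H
  no-short-relation {h} {n} sₕ 2h≤n z nonzero H extend x relation short = vec-ext λ j → begin
    lookup x j                              ≡⟨ sym (insertAt-punchIn x z b j) ⟩
    lookup (insertAt x z b) (punchIn z j)
      ≡⟨ short-relation-vanishes {h} sₕ (s≤s 2h≤n) {insertAt x z b} relation′
           (subst (_≤ h +ℕ h) (sym wt-Y) short′) (subst (λ w → Even w ⊎ NonzeroSplitting) (sym wt-Y) parity)
           (punchIn z j) (nonzero j) ⟩
    0#                                      ≡⟨ sym (lookup-0v j) ⟩
    lookup (0v n) j                         ∎
    where
    extension = extend x relation short
    b = proj₁ extension
    relation′ = proj₁ (proj₂ (extension))
    short′ = proj₁ (proj₂ (proj₂ (extension)))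
    parity = proj₂ (proj₂ (proj₂ (extension)))
    wt-Y = wt-insertAt x z b

  ParityBit : Carrier → ℕ → Set
  ParityBit b w = (b ≡ 0# × Even w) ⊎ (b ≡ 1# × ∃ λ A → w ≡ suc (A +ℕ A))

  parity-bit : ∀ w → ∃ λ b → ParityBit b w
  parity-bit w with even-or-odd w
  ... | inj₁ even = 0# , inj₁ (refl , even)
  ... | inj₂ odd  = 1# , inj₂ (refl , odd)

  parity-bit-evens : ∀ {b w h} → ParityBit b w → w ≤ h +ℕ h → wt₁ b +ℕ w ≤ h +ℕ h × Even (wt₁ b +ℕ w)
  parity-bit-evens {b} {w} {h} (inj₁ (b≡0 , A , w≡A+A)) short =
    subst (λ v → v ≤ h +ℕ h × Even v) (cong (_+ℕ w) (sym (wt₁-0 b≡0))) (short , A , w≡A+A)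
  parity-bit-evens {b} {w} {h} (inj₂ (b≡1 , A , w≡1+A+A)) short =
    subst (λ v → v ≤ h +ℕ h × Even v) (cong (_+ℕ w) (sym (wt₁-1 b≢0)))
      (subst (_≤ h +ℕ h) (sym 2+w≡) (ℕₚ.+-mono-≤ A<h A<h) , suc A , 2+w≡)
    where
    b≢0 : b ≢ 0#
    b≢0 b≡0 = 1≢0 (trans (sym b≡1) b≡0)
    A<h : A < h
    A<h = 1+m+m≤n+n⇒m<n (subst (_≤ h +ℕ h) w≡1+A+A short)
    2+w≡ : suc w ≡ suc A +ℕ suc A
    2+w≡ = trans (cong suc w≡1+A+A) (cong suc (sym (ℕₚ.+-suc A A)))

  check-matrix-dropping-zero : ∀ {h n m} (S : SₕLinearSet F h (suc n) m) → h +ℕ h ≤ n → ∀ {z} →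
    SₕLinearSet.elems S z ≡ 0v m → NoShortRelation (h +ℕ h) (SₕLinearSet.elems S ∘ punchIn z)
  check-matrix-dropping-zero {h} {m = m} S 2h≤n {z} aᶻ≡0 =
    no-short-relation sₕ 2h≤n z nonzero (a ∘ punchIn z) extend
    where
    open SₕLinearSet S renaming (elems to a)
    nonzero : ∀ j → a (punchIn z j) ≢ 0v m
    nonzero j eq = punchInᵢ≢i z j (distinct _ _ (trans eq (sym aᶻ≡0)))
    extend : ∀ x → lc x (a ∘ punchIn z) ≡ 0v m → wt x ≤ h +ℕ h → Extension h a z x
    extend x relation short = b , (begin
      lc (insertAt x z b) a                 ≡⟨ lc-insertAt x z b a ⟩
      b ⊙ a z ⊕ lc x (a ∘ punchIn z)        ≡⟨ cong₂ _⊕_ (trans (cong (b ⊙_) aᶻ≡0) (⊙0v b)) relation ⟩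
      0v m ⊕ 0v m                           ≡⟨ 0v⊕ (0v m) ⟩
      0v m                                  ∎) ,
      map₂ inj₁ (parity-bit-evens {h = h} (proj₂ (parity-bit (wt x))) short)
      where b = proj₁ (parity-bit (wt x))

  check-matrix-splitting : ∀ {h n m} (S : SₕLinearSet F h (suc n) m) → h +ℕ h ≤ n →
    (∀ i → SₕLinearSet.elems S i ≢ 0v m) → NonzeroSplitting →
    NoShortRelation (h +ℕ h) (SₕLinearSet.elems S ∘ Fin.suc)
  check-matrix-splitting {h} {m = m} S 2h≤n nonzero splitting =
    no-short-relation sₕ 2h≤n Fin.zero (nonzero ∘ Fin.suc) (a ∘ Fin.suc) extend
    where
    open SₕLinearSet S renaming (elems to a)
    extend : ∀ x → lc x (a ∘ Fin.suc) ≡ 0v m → wt x ≤ h +ℕ h → Extension h a Fin.zero x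
    extend x relation short =
      0# , trans (cong₂ _⊕_ (0#⊙ (a Fin.zero)) relation) (0v⊕ (0v m)) ,
      subst (_≤ h +ℕ h) (cong (_+ℕ wt x) (sym (wt₁-0 refl))) short , inj₂ splitting

  splitting-from : ∀ {w} → w ≢ 0# → w ≢ 1# → NonzeroSplitting
  splitting-from {w} w≢0 w≢1 = p , nonzero
    where
    p : Carrier → Carrier
    p y with (y + 1#) ≟ 0#
    ... | yes _ = w
    ... | no  _ = 1#
    nonzero : ∀ y → y ≢ 0# → p y ≢ 0# × y + p y ≢ 0#
    nonzero y _ with (y + 1#) ≟ 0#
    ... | yes y+1≡0 = w≢0 , λ y+w≡0 →
      w≢1 (trans (+-inverseʳ-unique y w y+w≡0) (sym (+-inverseʳ-unique y 1# y+1≡0)))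
    ... | no  y+1≢0 = 1≢0 , y+1≢0

  sum : ∀ {n} → Vector n → Carrier
  sum x = dot x (λ _ → 1#)

  lc-const : ∀ {m n} (x : Vector m) (v : Vector n) → lc x (λ _ → v) ≡ sum x ⊙ v
  lc-const x v = vec-ext λ l → begin
    lookup (lc x (λ _ → v)) l          ≡⟨ lookup-lc x (λ _ → v) l ⟩
    dot x (λ _ → lookup v l)           ≡⟨ dot-cong x (λ _ → sym (*-identityʳ (lookup v l))) ⟩
    dot x (λ _ → lookup v l * 1#)      ≡⟨ dot-* x (lookup v l) (λ _ → 1#) ⟩
    lookup v l * sum x                 ≡⟨ *-comm _ _ ⟩
    sum x * lookup v l                 ≡⟨ sym (lookup-⊙ (sum x) v l) ⟩
    lookup (sum x ⊙ v) l               ∎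

  lc-pointwise-⊕ : ∀ {m n} (x : Vector m) (a b : Fin m → Vector n) →
                   lc x (λ i → a i ⊕ b i) ≡ lc x a ⊕ lc x b
  lc-pointwise-⊕ x a b = vec-ext λ j → begin
    lookup (lc x (λ i → a i ⊕ b i)) j                   ≡⟨ lookup-lc x _ j ⟩
    dot x (λ i → lookup (a i ⊕ b i) j)                  ≡⟨ dot-cong x (λ i → lookup-⊕ (a i) (b i) j) ⟩
    dot x (λ i → lookup (a i) j + lookup (b i) j)       ≡⟨ dot-+ x _ _ ⟩
    dot x _ + dot x _                                   ≡⟨ sym (cong₂ _+_ (lookup-lc x a j) (lookup-lc x b j)) ⟩
    lookup (lc x a) j + lookup (lc x b) j               ≡⟨ sym (lookup-⊕ (lc x a) (lc x b) j) ⟩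
    lookup (lc x a ⊕ lc x b) j                          ∎

  sum-parity-bit : (∀ y → y ≡ 0# ⊎ y ≡ 1#) → ∀ {n} (x : Vector n) → ParityBit (sum x) (wt x)
  sum-parity-bit binary []       = inj₁ (refl , 0 , refl)
  sum-parity-bit binary (y ∷ xs) = step (binary y) (sum-parity-bit binary xs)
    where
    1+1≡0 : 1# + 1# ≡ 0#
    1+1≡0 with binary (1# + 1#)
    ... | inj₁ 1+1≡0 = 1+1≡0
    ... | inj₂ 1+1≡1 = ⊥-elim (1≢0 (x+y≡y⇒x≡0 1# 1# 1+1≡1))
    wt-y∷xs : ∀ {i} → wt₁ y ≡ i → wt (y ∷ xs) ≡ i +ℕ wt xs
    wt-y∷xs wt-y = trans (wt-∷ y xs) (cong (_+ℕ wt xs) wt-y)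
    y≢0 : y ≡ 1# → y ≢ 0#
    y≢0 y≡1 y≡0 = 1≢0 (trans (sym y≡1) y≡0)
    sum≡ : ∀ {t} → y ≡ t → sum (y ∷ xs) ≡ t + sum xs
    sum≡ y≡t = cong (_+ sum xs) (trans (*-identityʳ y) y≡t)
    step : y ≡ 0# ⊎ y ≡ 1# → ParityBit (sum xs) (wt xs) → ParityBit (sum (y ∷ xs)) (wt (y ∷ xs))
    step (inj₁ y≡0) (inj₁ (s≡0 , A , w≡)) =
      inj₁ (trans (sum≡ y≡0) (trans (+-identityˡ _) s≡0) , A , trans (wt-y∷xs (wt₁-0 y≡0)) w≡)
    step (inj₁ y≡0) (inj₂ (s≡1 , A , w≡)) =
      inj₂ (trans (sum≡ y≡0) (trans (+-identityˡ _) s≡1) , A , trans (wt-y∷xs (wt₁-0 y≡0)) w≡)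
    step (inj₂ y≡1) (inj₁ (s≡0 , A , w≡)) =
      inj₂ (trans (sum≡ y≡1) (trans (cong (1# +_) s≡0) (+-identityʳ 1#)) , A ,
            trans (wt-y∷xs (wt₁-1 (y≢0 y≡1))) (cong suc w≡))
    step (inj₂ y≡1) (inj₂ (s≡1 , A , w≡)) =
      inj₁ (trans (sum≡ y≡1) (trans (cong (1# +_) s≡1) 1+1≡0) , suc A ,
            trans (wt-y∷xs (wt₁-1 (y≢0 y≡1))) (trans (cong suc w≡) (cong suc (sym (ℕₚ.+-suc A A)))))

  -- Over F₂, a (j + 1) + a 0 = a (j + 1) − a 0, so x extends to a relation by its coordinate sum, which is the
  -- parity of its weight.
  check-matrix-F₂ : ∀ {h n m} (S : SₕLinearSet F h (suc n) m) → h +ℕ h ≤ n →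
    (∀ i → SₕLinearSet.elems S i ≢ 0v m) → (∀ y → y ≡ 0# ⊎ y ≡ 1#) →
    NoShortRelation (h +ℕ h) (λ j → SₕLinearSet.elems S (Fin.suc j) ⊕ SₕLinearSet.elems S Fin.zero)
  check-matrix-F₂ {h} {m = m} S 2h≤n nonzero binary =
    no-short-relation sₕ 2h≤n Fin.zero (nonzero ∘ Fin.suc) (λ j → a (Fin.suc j) ⊕ a Fin.zero) extend
    where
    open SₕLinearSet S renaming (elems to a)
    extend : ∀ x → lc x (λ j → a (Fin.suc j) ⊕ a Fin.zero) ≡ 0v m → wt x ≤ h +ℕ h →
             Extension h a Fin.zero x
    extend x relation short = sum x , (begin
      sum x ⊙ a Fin.zero ⊕ lc x (a ∘ Fin.suc)          ≡⟨ ⊕-comm _ _ ⟩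
      lc x (a ∘ Fin.suc) ⊕ sum x ⊙ a Fin.zero          ≡⟨ cong (lc x (a ∘ Fin.suc) ⊕_) (sym (lc-const x _)) ⟩
      lc x (a ∘ Fin.suc) ⊕ lc x (λ _ → a Fin.zero)     ≡⟨ sym (lc-pointwise-⊕ x (a ∘ Fin.suc) _) ⟩
      lc x (λ j → a (Fin.suc j) ⊕ a Fin.zero)          ≡⟨ relation ⟩
      0v m                                             ∎) ,
      map₂ inj₁ (parity-bit-evens {h = h} (sum-parity-bit binary x) short)

  ∃-Carrier? : {P : Carrier → Set} → (∀ y → Dec (P y)) → Dec (∃ P)
  ∃-Carrier? {P} P? with any? (λ i → P? (to i))
  ... | yes (i , p) = yes (to i , p)
  ... | no  none    = no λ (y , p) → none (from y , subst P (sym (to∘from y)) p)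

  check-matrix : ∀ {h n m} → h +ℕ h ≤ n → SₕLinearSet F h (suc n) m →
                 Σ (Fin n → Vector m) (NoShortRelation (h +ℕ h))
  check-matrix {m = m} 2h≤n S with any? (λ z → ≡-dec _≟_ (SₕLinearSet.elems S z) (0v m))
  ... | yes (z , aᶻ≡0) = _ , check-matrix-dropping-zero S 2h≤n aᶻ≡0
  ... | no  no-zero with ∃-Carrier? (λ w → ¬? (w ≟ 0#) ×-dec ¬? (w ≟ 1#))
  ...   | yes (_ , w≢0 , w≢1) = _ , check-matrix-splitting S 2h≤n nonzero (splitting-from w≢0 w≢1)
    where nonzero = λ i aᵢ≡0 → no-zero (i , aᵢ≡0)
  ...   | no  only-0-1        = _ , check-matrix-F₂ S 2h≤n nonzero binary
    where
    nonzero = λ i aᵢ≡0 → no-zero (i , aᵢ≡0)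
    binary : ∀ y → y ≡ 0# ⊎ y ≡ 1#
    binary y with y ≟ 0# | y ≟ 1#
    ... | yes y≡0 | _       = inj₁ y≡0
    ... | no _    | yes y≡1 = inj₂ y≡1
    ... | no y≢0  | no y≢1  = ⊥-elim (only-0-1 (y , y≢0 , y≢1))

  ∃-Vector? : ∀ k {P : Vector k → Set} → (∀ c → Dec (P c)) → Dec (∃ P)
  ∃-Vector? zero    P? = map′ ([] ,_) (λ { ([] , p) → p }) (P? [])
  ∃-Vector? (suc k) P? = map′ (λ (y , cs , p) → y ∷ cs , p) (λ { (y ∷ cs , p) → y , cs , p })
    (∃-Carrier? λ y → ∃-Vector? k λ cs → P? (y ∷ cs))

  minimum-distance : ∀ {n k} (C : LinearCode F n (suc k)) → ∃ (MinDistance F C)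
  minimum-distance {n} {k} C = d , (lc c basis , (c , refl) , c-nonzero , wt≡d) , d≤wt
    where
    open LinearCode C
    NonzeroCodewordOfWeight : ℕ → Set
    NonzeroCodewordOfWeight w = ∃ λ c → lc c basis ≢ 0v n × wt (lc c basis) ≡ w
    decide : ∀ w → Dec (NonzeroCodewordOfWeight w)
    decide w = ∃-Vector? (suc k) λ c → ¬? (≡-dec _≟_ (lc c basis) (0v n)) ×-dec (wt (lc c basis) ℕ.≟ w)
    first-basis-vector : NonzeroCodewordOfWeight (wt (basis Fin.zero))
    first-basis-vector = unit Fin.zero ,
      (λ eq → independent⇒nonzero independent Fin.zero (trans (sym (lc-unitˡ Fin.zero basis)) eq)) ,
      cong wt (lc-unitˡ Fin.zero basis)
    lightest = least decide first-basis-vector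
    d = proj₁ lightest
    c = proj₁ (proj₁ (proj₂ lightest))
    c-nonzero = proj₁ (proj₂ (proj₁ (proj₂ lightest)))
    wt≡d = proj₂ (proj₂ (proj₁ (proj₂ lightest)))
    d≤wt : ∀ v → IsCodeword F C v → v ≢ 0v n → d ≤ wt v
    d≤wt v (c′ , c′≡v) v≢0 = ℕₚ.≮⇒≥ λ wt<d →
      proj₂ (proj₂ lightest) wt<d (c′ , (λ eq → v≢0 (trans (sym c′≡v) eq)) , cong wt c′≡v)

  code-from-check-matrix : ∀ {w m n k} (H : Fin n → Vector m) → NoShortRelation w H → m +ℕ suc k ≤ n →
                           ∃ λ d → Code[_,_,_] F n (suc k) d × w < d
  code-from-check-matrix {w} {m} H no-short m+k≤n =
    d , record { code = C ; minDist = minDist } ,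
    ℕₚ.≰⇒> λ d≤w → v≢0 (no-short v v∈ker (subst (_≤ w) (sym wt≡d) d≤w))
    where
    family = kernel-family m m+k≤n H
    C : LinearCode F _ _
    C = record { basis = proj₁ family ; independent = proj₁ (proj₂ family) }
    d = proj₁ (minimum-distance C)
    minDist = proj₂ (minimum-distance C)
    v = proj₁ (proj₁ minDist)
    c = proj₁ (proj₁ (proj₂ (proj₁ minDist)))
    c≡v = proj₂ (proj₁ (proj₂ (proj₁ minDist)))
    v≢0 = proj₁ (proj₂ (proj₂ (proj₁ minDist)))
    wt≡d = proj₂ (proj₂ (proj₂ (proj₁ minDist)))
    v∈ker : lc v H ≡ 0v m
    v∈ker = begin
      lc v H                                ≡⟨ cong (λ u → lc u H) (sym c≡v) ⟩
      lc (lc c (proj₁ family)) H            ≡⟨ sym (lc-lc c (proj₁ family) H) ⟩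
      lc c (λ i → lc (proj₁ family i) H)    ≡⟨ lc-cong c (proj₂ (proj₂ family)) ⟩
      lc c (λ _ → 0v m)                     ≡⟨ lc-0 c ⟩
      0v m                                  ∎

  no-short-relation⇒nonzero : ∀ {w n m} {H : Fin n → Vector m} → NoShortRelation w H → 1 ≤ w →
                              ∀ i → H i ≢ 0v m
  no-short-relation⇒nonzero {w} {n} {H = H} no-short 1≤w i Hᵢ≡0 = 1≢0 (begin
    1#                  ≡⟨ sym (lookup-unit-≡ i) ⟩
    lookup (unit i) i   ≡⟨ cong (λ v → lookup v i) (no-short (unit i) (trans (lc-unitˡ i H) Hᵢ≡0)
                                                     (subst (_≤ w) (sym (wt-unit i)) 1≤w)) ⟩
    lookup (0v n) i     ≡⟨ lookup-0v i ⟩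
    0#                  ∎)

  no-short-relation⇒injective : ∀ {w n m} {H : Fin n → Vector m} → NoShortRelation w H → 2 ≤ w →
                                ∀ {i j} → H i ≡ H j → i ≡ j
  no-short-relation⇒injective {w} {n} {m} {H} no-short 2≤w {i} {j} Hᵢ≡Hⱼ with i Fin.≟ j
  ... | yes i≡j = i≡j
  ... | no  i≢j = ⊥-elim (1≢0 (begin
    1#                                       ≡⟨ sym (+-identityʳ 1#) ⟩
    1# + 0#                                  ≡⟨ cong₂ _+_ (sym (lookup-unit-≡ i))
                                                   (sym (trans (cong -_ (lookup-unit-≢ i≢j)) -0#≈0#)) ⟩
    lookup (unit i) i + - lookup (unit j) i  ≡⟨ sym (lookup-⊖ (unit i) (unit j) i) ⟩
    lookup x i                               ≡⟨ cong (λ v → lookup v i) (no-short x x∈ker short) ⟩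
    lookup (0v n) i                          ≡⟨ lookup-0v i ⟩
    0#                                       ∎))
    where
    x = unit i ⊖ unit j
    x∈ker : lc x H ≡ 0v m
    x∈ker = trans (lc-⊖ (unit i) (unit j) H)
      (trans (cong₂ _⊖_ (trans (lc-unitˡ i H) Hᵢ≡Hⱼ) (lc-unitˡ j H)) (⊖-self (H j)))
    short : wt x ≤ w
    short = ℕₚ.≤-trans (wt-⊖ (unit i) (unit j))
      (subst (_≤ w) (sym (cong₂ _+ℕ_ (wt-unit i) (wt-unit j))) 2≤w)

  -- The zero element contributes nothing, so two h-combinations agree off it, and then they have the same
  -- number of nonzero coefficients on it.
  zero∷-isSₕ : ∀ {h n m} {H : Fin n → Vector m} → NoShortRelation (h +ℕ h) H →
               IsSₕLinearSet F h (0v m ∷ᶠ H)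
  zero∷-isSₕ {h} {n} {m} {H} no-short (c₀ ∷ c) (c₀′ ∷ c′) wt-c wt-c′ same-value = agree
    where
    drop-zero : ∀ b (t : Vector n) → lc (b ∷ t) (0v m ∷ᶠ H) ≡ lc t H
    drop-zero b t = trans (cong (_⊕ lc t H) (⊙0v b)) (0v⊕ (lc t H))
    wt-∷≡h : ∀ b (t : Vector n) → wt (b ∷ t) ≡ h → wt₁ b +ℕ wt t ≡ h
    wt-∷≡h b t = trans (sym (wt-∷ b t))
    wt≤h : ∀ b (t : Vector n) → wt (b ∷ t) ≡ h → wt t ≤ h
    wt≤h b t eq = subst (wt t ≤_) (wt-∷≡h b t eq) (ℕₚ.m≤n+m (wt t) (wt₁ b))
    c≡c′ : c ≡ c′
    c≡c′ = u⊖v≡0⇒u≡v (no-short (c ⊖ c′) (begin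
      lc (c ⊖ c′) H        ≡⟨ lc-⊖ c c′ H ⟩
      lc c H ⊖ lc c′ H     ≡⟨ cong (_⊖ lc c′ H) (trans (sym (drop-zero c₀ c))
                                                        (trans same-value (drop-zero c₀′ c′))) ⟩
      lc c′ H ⊖ lc c′ H    ≡⟨ ⊖-self (lc c′ H) ⟩
      0v m                 ∎)
      (ℕₚ.≤-trans (wt-⊖ c c′) (ℕₚ.+-mono-≤ (wt≤h c₀ c wt-c) (wt≤h c₀′ c′ wt-c′))))
    wt₁-c₀≡ : wt₁ c₀ ≡ wt₁ c₀′
    wt₁-c₀≡ = ℕₚ.+-cancelʳ-≡ (wt c) (wt₁ c₀) (wt₁ c₀′)
      (trans (wt-∷≡h c₀ c wt-c)
             (sym (trans (cong (λ t → wt₁ c₀′ +ℕ wt t) c≡c′) (wt-∷≡h c₀′ c′ wt-c′))))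
    agree : ∀ i → _
    agree Fin.zero    = (λ c₀≡0 → wt₁≡0⇒≡0 (trans (sym wt₁-c₀≡) (wt₁-0 c₀≡0))) ,
                        (λ c₀′≡0 → wt₁≡0⇒≡0 (trans wt₁-c₀≡ (wt₁-0 c₀′≡0))) ,
                        (λ 0≢0 → ⊥-elim (0≢0 refl))
    agree (Fin.suc l) = (λ cₗ≡0 → trans (sym (cong (λ t → lookup t l) c≡c′)) cₗ≡0) ,
                        (λ c′ₗ≡0 → trans (cong (λ t → lookup t l) c≡c′) c′ₗ≡0) ,
                        (λ _ → cong (λ t → lookup t l) c≡c′)

  sₕ-set-from-check-matrix : ∀ {h n m} (H : Fin n → Vector m) → 1 ≤ h → NoShortRelation (h +ℕ h) H →
                             SₕLinearSet F h (suc n) m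
  sₕ-set-from-check-matrix {h} {m = m} H 1≤h no-short =
    record { elems = 0v m ∷ᶠ H ; distinct = distinct ; sₕ = zero∷-isSₕ no-short }
    where
    nonzero = no-short-relation⇒nonzero no-short (ℕₚ.≤-trans 1≤h (ℕₚ.m≤m+n h h))
    distinct : ∀ i j → (0v m ∷ᶠ H) i ≡ (0v m ∷ᶠ H) j → i ≡ j
    distinct Fin.zero    Fin.zero    _  = refl
    distinct Fin.zero    (Fin.suc j) eq = ⊥-elim (nonzero j (sym eq))
    distinct (Fin.suc i) Fin.zero    eq = ⊥-elim (nonzero i eq)
    distinct (Fin.suc i) (Fin.suc j) eq =
      cong Fin.suc (no-short-relation⇒injective no-short (ℕₚ.+-mono-≤ 1≤h 1≤h) eq)

  sₕ-set-from-code : ∀ {h n k d} → 1 ≤ h → Code[_,_,_] F n k d → h +ℕ h < d →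
                     SₕLinearSet F h (suc n) (n ∸ k)
  sₕ-set-from-code {h} {n} {k} 1≤h C 2h<d = sₕ-set-from-check-matrix H 1≤h no-short
    where
    open Code[_,_,_] C
    open LinearCode code
    check = parity-check k basis independent
    H = proj₁ check
    no-short : NoShortRelation (h +ℕ h) H
    no-short x x∈ker short with ≡-dec _≟_ x (0v n)
    ... | yes x≡0 = x≡0
    ... | no  x≢0 =
      ⊥-elim (ℕₚ.<⇒≱ 2h<d (ℕₚ.≤-trans (proj₂ minDist x (proj₂ check x x∈ker) x≢0) short))

  code-from-sₕ-set : ∀ {h n k} → 1 ≤ h → 1 ≤ k → h +ℕ h ≤ n ∸ k → SₕLinearSet F h (suc n) (n ∸ k) →
                     ∃ λ d → Code[_,_,_] F n k d × h +ℕ h < d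
  code-from-sₕ-set {h} {n} {suc k} 1≤h _ 2h≤n-k S =
    code-from-check-matrix (proj₁ check) (proj₂ check) (ℕₚ.≤-reflexive (ℕₚ.m∸n+n≡m k<n))
    where
    check = check-matrix (ℕₚ.≤-trans 2h≤n-k (ℕₚ.m∸n≤m n (suc k))) S
    k<n : suc k ≤ n
    k<n = ℕₚ.<⇒≤ (ℕₚ.m∸n≢0⇒n<m λ n-k≡0 →
      ℕₚ.<⇒≱ (ℕₚ.≤-trans 1≤h (ℕₚ.m≤m+n h h)) (subst (h +ℕ h ≤_) n-k≡0 2h≤n-k))

open import Data.Nat using (_+_; _*_)
open import Function.Bundles using (_⇔_; mk⇔)

theorem3p15 : (F : FiniteField) (h n k : ℕ) → 1 ≤ h → 1 ≤ n → 1 ≤ k →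
    2 * h ≤ n ∸ k →
    ((∃ λ d → Code[_,_,_] F n k d × 2 * h + 1 ≤ d) ⇔ SₕLinearSet F h (suc n) (n ∸ k))
theorem3p15 F h n k 1≤h _ 1≤k 2h≤n-k = mk⇔
  (λ (d , C , 2h+1≤d) → sₕ-set-from-code F 1≤h C (subst (_≤ d) 2h+1≡1+h+h 2h+1≤d))
  (λ S → let d , C , 2h<d = code-from-sₕ-set F 1≤h 1≤k (subst (_≤ n ∸ k) 2h≡h+h 2h≤n-k) S
         in d , C , subst (_≤ d) (sym 2h+1≡1+h+h) 2h<d)
  where
  2h≡h+h : 2 * h ≡ h + h
  2h≡h+h = cong (h +_) (ℕₚ.+-identityʳ h)
  2h+1≡1+h+h : 2 * h + 1 ≡ suc (h + h)
  2h+1≡1+h+h = trans (ℕₚ.+-comm (2 * h) 1) (cong suc 2h≡h+h)
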